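{- The field $\mathbb{Q}(\sqrt{ -10})$ is $\{2\}$-norm-Euclidean.
   Context: For $K=\mathbb{Q}(\sqrt{ -10})$, $\mathcal{O}=\mathbb{Z}[\sqrt{ -10}]$, $N(x+y\sqrt{ -10})=x^2+10y^2$. With $S=\{2\}$, $\mathcal{O}_S=\{(a+b\sqrt{ -10})/2^n: a,b\in\mathbb{Z}, n\ge 0\}$. For nonzero $\xi\in K$, $N_S(\xi)$ is the positive rational obtained from $N(\xi)$ by deleting the prime $2$ from the prime factorizations of its numerator and denominator; $N_S(0)=0$. $K$ is $S$-norm-Euclidean if for every $\xi\in K$ there exists $\gamma\in\mathcal{O}_S$ with $N_S(\xi-\gamma)<1$. -}

module Defs where

open import Data.Bool using (Bool; if_then_else_)
open import Data.Nat as ℕ using (ℕ; zero; suc; ⌊_/2⌋; _%_; _≡ᵇ_; _∸_)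
open import Data.Integer as ℤ using (ℤ; +_; ∣_∣)
open import Data.Rational as ℚ using (ℚ; _+_; _-_; _*_; _<_; ½; 1ℚ; fromℚᵘ)
open import Data.Rational.Unnormalised as ℚᵘ using (mkℚᵘ)
open import Data.Product using (Σ; _×_; _,_)

-- Odd part of a natural number: n with all factors 2 removed (oddPart 0 = 0).
-- Implemented with fuel; fuel n is enough since each step halves the argument.
oddPart-aux : ℕ → ℕ → ℕ
oddPart-aux zero    n       = n
oddPart-aux (suc f) zero    = zero
oddPart-aux (suc f) (suc m) =
  if (suc m % 2) ≡ᵇ 0 then oddPart-aux f ⌊ suc m /2⌋ else suc m

oddPart : ℕ → ℕ
oddPart n = oddPart-aux n n

-- Elements of K = ℚ(√-10), written a + b√-10 with a b ∈ ℚ.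
K : Set
K = ℚ × ℚ

_-K_ : K → K → K
(a , b) -K (c , d) = (a - c , b - d)

ℚ10 : ℚ
ℚ10 = ℤ.+ 10 ℚ./ 1

N : K → ℚ
N (a , b) = a * a + ℚ10 * (b * b)

-- N_S for S = {2}: delete the prime 2 from numerator and denominator of a
-- (nonnegative) rational; gives 0 on 0.  (Applied to the numerator's absolute
-- value; norms are ≥ 0 anyway.)
N₂ : ℚ → ℚ
N₂ q = fromℚᵘ (mkℚᵘ (+ oddPart ∣ ℚ.↥ q ∣) (oddPart (ℚ.↧ₙ q) ∸ 1))

N_S : K → ℚ
N_S ξ = N₂ (N ξ)

halfPow : ℕ → ℚ
halfPow zero    = 1ℚ
halfPow (suc n) = ½ * halfPow n

-- Elements of O_S = { (a + b√-10)/2^n : a b ∈ ℤ, n ≥ 0 }, given by (a , b , n).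
O_S : Set
O_S = ℤ × ℤ × ℕ

ι : O_S → K
ι (a , b , n) = ((a ℚ./ 1) * halfPow n , (b ℚ./ 1) * halfPow n)

SNormEuclidean : Set
SNormEuclidean = (ξ : K) → Σ O_S (λ γ → N_S (ξ -K ι γ) < 1ℚ)

{-# OPTIONS --safe #-}
module Submission where

open import Defs

-- Write ξ = (x + y√-10) / D with D = 2^s m and m odd. Since γ may carry the denominator 2^s and N_S
-- ignores powers of 2, it suffices to find integers c, d with
-- oddPart ((x − c m)² + 10 (y − d m)²) < m².  As 4 is invertible modulo m, x ≡ 4X and y ≡ 4Y with
-- 0 ≤ X, Y < m, and for a shift (k, l) in 4ℤ×4ℤ, 4ℤ×2ℤ or 2ℤ×ℤ the norm of (4X + k m, 4Y + l m) is
-- divisible by 16, 8 or 2; so it is enough that this norm stays below that power of 2 times m².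
-- Whether a small shift achieves this depends only on (X/m, Y/m) ∈ [0,1)², and a 32 × 32 grid of
-- cells, each checked at its corners by computation, shows that one always does.

module OddPart where

  open import Data.Nat
  open import Data.Nat.Properties
  open import Data.Nat.DivMod using (m*n%n≡0; %-distribˡ-*; m%n<n)
  open import Data.Product using (Σ; _×_; _,_; proj₁; proj₂)
  open import Data.Empty using (⊥-elim)
  open import Relation.Binary.PropositionalEquality

  Odd : ℕ → Set
  Odd n = n % 2 ≡ 1

  odd-* : ∀ {a b} → Odd a → Odd b → Odd (a * b)
  odd-* {a} {b} oa ob = trans (%-distribˡ-* a b 2) (cong₂ (λ p q → (p * q) % 2) oa ob)

  odd≢double : ∀ {o} t → Odd o → o ≢ 2 * t
  odd≢double t odd refl with trans (sym odd) (trans (cong (_% 2) (*-comm 2 t)) (m*n%n≡0 t 2))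
  ... | ()

  odd⇒nonZero : ∀ {o} → Odd o → NonZero o
  odd⇒nonZero {suc o} _ = _

  2*⌊n/2⌋+n%2≡n : ∀ n → 2 * ⌊ n /2⌋ + n % 2 ≡ n
  2*⌊n/2⌋+n%2≡n zero = refl
  2*⌊n/2⌋+n%2≡n (suc zero) = refl
  2*⌊n/2⌋+n%2≡n (suc (suc n)) = begin
    2 * suc ⌊ n /2⌋ + n % 2     ≡⟨ cong (_+ n % 2) (*-suc 2 ⌊ n /2⌋) ⟩
    2 + 2 * ⌊ n /2⌋ + n % 2     ≡⟨ cong (2 +_) (2*⌊n/2⌋+n%2≡n n) ⟩
    suc (suc n)                 ∎
    where open ≡-Reasoning

  TwoAdicForm : ℕ → ℕ → ℕ → Set
  TwoAdicForm n k o = n ≡ 2 ^ k * o × Odd o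

  oddPart-aux-TwoAdicForm : ∀ f n .{{_ : NonZero n}} → n ≤ f → Σ ℕ λ k → TwoAdicForm n k (oddPart-aux f n)
  oddPart-aux-TwoAdicForm (suc f) n@(suc _) n≤1+f with n % 2 in r | m%n<n n 2
  ... | 1 | _ = 0 , sym (+-identityʳ n) , r
  ... | 0 | _ = suc k , n≡2^[1+k]*o , odd
    where
      n≡2*h : n ≡ 2 * ⌊ n /2⌋
      n≡2*h = trans (sym (2*⌊n/2⌋+n%2≡n n)) (trans (cong (2 * ⌊ n /2⌋ +_) r) (+-identityʳ _))
      instance
        h≢0 : NonZero ⌊ n /2⌋
        h≢0 = m*n≢0⇒n≢0 2 {{subst NonZero n≡2*h _}}
      half : Σ ℕ λ k → TwoAdicForm ⌊ n /2⌋ k (oddPart-aux f ⌊ n /2⌋)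
      half = oddPart-aux-TwoAdicForm f ⌊ n /2⌋ (≤-pred (≤-trans (⌊n/2⌋<n _) n≤1+f))
      k = proj₁ half
      n≡2^[1+k]*o = trans n≡2*h (trans (cong (2 *_) (proj₁ (proj₂ half))) (sym (*-assoc 2 (2 ^ k) _)))
      odd = proj₂ (proj₂ half)
  ... | 2+ _ | s≤s (s≤s ())

  oddPart-TwoAdicForm : ∀ n .{{_ : NonZero n}} → Σ ℕ λ k → TwoAdicForm n k (oddPart n)
  oddPart-TwoAdicForm n = oddPart-aux-TwoAdicForm n n ≤-refl

  odd≢2^[1+b]*o : ∀ b {o o′} → Odd o → o ≢ 2 ^ suc b * o′
  odd≢2^[1+b]*o b {o′ = o′} odd o≡ = odd≢double (2 ^ b * o′) odd (trans o≡ (*-assoc 2 (2 ^ b) o′))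

  TwoAdicForm-unique : ∀ a b {n o o′} → TwoAdicForm n a o → TwoAdicForm n b o′ → o ≡ o′
  TwoAdicForm-unique zero zero (refl , _) (n≡o′ , _) = trans (sym (+-identityʳ _)) (trans n≡o′ (+-identityʳ _))
  TwoAdicForm-unique zero (suc b) (refl , odd) (n≡ , _) = ⊥-elim (odd≢2^[1+b]*o b odd (trans (sym (+-identityʳ _)) n≡))
  TwoAdicForm-unique (suc a) zero (n≡ , _) (refl , odd′) = ⊥-elim (odd≢2^[1+b]*o a odd′ (trans (sym (+-identityʳ _)) n≡))
  TwoAdicForm-unique (suc a) (suc b) {o = o} {o′} (refl , odd) (n≡ , odd′) =
    TwoAdicForm-unique a b (refl , odd)
      (*-cancelˡ-≡ (2 ^ a * o) (2 ^ b * o′) 2 (trans (sym (*-assoc 2 (2 ^ a) o)) (trans n≡ (*-assoc 2 (2 ^ b) o′))) , odd′)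

  oddPart-2^k*o : ∀ k {o} → Odd o → oddPart (2 ^ k * o) ≡ o
  oddPart-2^k*o k {o} odd = TwoAdicForm-unique (proj₁ form) k (proj₂ form) (refl , odd)
    where
      instance
        n≢0 : NonZero (2 ^ k * o)
        n≢0 = m*n≢0 (2 ^ k) o {{m^n≢0 2 k}} {{odd⇒nonZero odd}}
      form = oddPart-TwoAdicForm (2 ^ k * o)

  oddPart-2^k : ∀ k → oddPart (2 ^ k) ≡ 1
  oddPart-2^k k = trans (cong oddPart (sym (*-identityʳ (2 ^ k)))) (oddPart-2^k*o k refl)

  oddPart-odd : ∀ {n} .{{_ : NonZero n}} → Odd (oddPart n)
  oddPart-odd {n} = proj₂ (proj₂ (oddPart-TwoAdicForm n))

  oddPart-* : ∀ a b → oddPart (a * b) ≡ oddPart a * oddPart b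
  oddPart-* zero b = refl
  oddPart-* a@(suc _) zero = trans (cong oddPart (*-zeroʳ a)) (sym (*-zeroʳ (oddPart a)))
  oddPart-* a@(suc _) b@(suc _) with i , a≡ , oa ← oddPart-TwoAdicForm a | j , b≡ , ob ← oddPart-TwoAdicForm b =
    trans (cong oddPart a*b≡) (oddPart-2^k*o (i + j) (odd-* {oddPart a} {oddPart b} oa ob))
    where
      a*b≡ : a * b ≡ 2 ^ (i + j) * (oddPart a * oddPart b)
      a*b≡ = begin
        a * b                                          ≡⟨ cong₂ _*_ a≡ b≡ ⟩
        (2 ^ i * oddPart a) * (2 ^ j * oddPart b)      ≡⟨ [m*n]*[o*p]≡[m*o]*[n*p] (2 ^ i) _ (2 ^ j) _ ⟩
        (2 ^ i * 2 ^ j) * (oddPart a * oddPart b)      ≡⟨ cong (_* _) (sym (^-distribˡ-+-* 2 i j)) ⟩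
        2 ^ (i + j) * (oddPart a * oddPart b)          ∎
        where open ≡-Reasoning

  oddPart-≤ : ∀ n → oddPart n ≤ n
  oddPart-≤ zero = z≤n
  oddPart-≤ n@(suc _) with k , n≡ , _ ← oddPart-TwoAdicForm n =
    subst (oddPart n ≤_) (sym n≡) (m≤n*m (oddPart n) (2 ^ k) {{m^n≢0 2 k}})

module Fractions where

  open import Data.Nat as ℕ using (zero; suc; _^_)
  open import Data.Integer using (ℤ; +_; _+_; _*_; -_; NonZero)
  import Data.Integer.Properties as ℤ
  open import Data.Integer.Tactic.RingSolver using (solve-∀)
  open import Data.Rational as ℚ using (ℚ; mkℚ; toℚᵘ; ½)
  import Data.Rational.Properties as ℚ
  open import Data.Rational.Unnormalised as ℚᵘ using (ℚᵘ; mkℚᵘ; *≡*; _≃_)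
  import Data.Rational.Unnormalised.Properties as ℚᵘ
  open import Function using (_$_)
  open import Relation.Binary.PropositionalEquality

  infix 4 _≐ᵘ_/_ _≐_/_

  record _≐ᵘ_/_ (p : ℚᵘ) (A B : ℤ) : Set where
    constructor cross
    field ↥*≡*↧ : ℚᵘ.↥ p * B ≡ A * ℚᵘ.↧ p

  _≐_/_ : ℚ → ℤ → ℤ → Set
  q ≐ A / B = toℚᵘ q ≐ᵘ A / B

  ≐ᵘ-+ : ∀ {p q A B C E} → p ≐ᵘ A / B → q ≐ᵘ C / E → p ℚᵘ.+ q ≐ᵘ A * E + C * B / B * E
  ≐ᵘ-+ {mkℚᵘ P d} {mkℚᵘ Q e} {A} {B} {C} {E} (cross P*B≡A*p) (cross Q*E≡C*q) = cross $ begin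
    (P * + suc e + Q * + suc d) * (B * E)           ≡⟨ spread P Q (+ suc d) (+ suc e) B E ⟩
    (P * B) * (+ suc e * E) + (Q * E) * (+ suc d * B) ≡⟨ cong₂ (λ a b → a * (+ suc e * E) + b * (+ suc d * B)) P*B≡A*p Q*E≡C*q ⟩
    (A * + suc d) * (+ suc e * E) + (C * + suc e) * (+ suc d * B) ≡⟨ collect A C (+ suc d) (+ suc e) B E ⟩
    (A * E + C * B) * (+ suc d * + suc e)           ≡⟨ cong ((A * E + C * B) *_) (ℤ.pos-* (suc d) (suc e)) ⟨
    (A * E + C * B) * + (suc d ℕ.* suc e)           ∎
    where
      open ≡-Reasoning
      spread : ∀ P Q p q B E → (P * q + Q * p) * (B * E) ≡ (P * B) * (q * E) + (Q * E) * (p * B)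
      spread = solve-∀
      collect : ∀ A C p q B E → (A * p) * (q * E) + (C * q) * (p * B) ≡ (A * E + C * B) * (p * q)
      collect = solve-∀

  ≐ᵘ-* : ∀ {p q A B C E} → p ≐ᵘ A / B → q ≐ᵘ C / E → p ℚᵘ.* q ≐ᵘ A * C / B * E
  ≐ᵘ-* {mkℚᵘ P d} {mkℚᵘ Q e} {A} {B} {C} {E} (cross P*B≡A*p) (cross Q*E≡C*q) = cross $ begin
    (P * Q) * (B * E)                       ≡⟨ swap P Q B E ⟩
    (P * B) * (Q * E)                       ≡⟨ cong₂ _*_ P*B≡A*p Q*E≡C*q ⟩
    (A * + suc d) * (C * + suc e)           ≡⟨ swap A (+ suc d) C (+ suc e) ⟩
    (A * C) * (+ suc d * + suc e)           ≡⟨ cong ((A * C) *_) (ℤ.pos-* (suc d) (suc e)) ⟨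
    (A * C) * + (suc d ℕ.* suc e)           ∎
    where
      open ≡-Reasoning
      swap : ∀ a b c d → (a * b) * (c * d) ≡ (a * c) * (b * d)
      swap = solve-∀

  ≐ᵘ-neg : ∀ {p A B} → p ≐ᵘ A / B → ℚᵘ.- p ≐ᵘ - A / B
  ≐ᵘ-neg {mkℚᵘ P d} {A} {B} (cross P*B≡A*p) = cross $
    trans (sym (ℤ.neg-distribˡ-* P B)) (trans (cong -_ P*B≡A*p) (ℤ.neg-distribˡ-* A (+ suc d)))

  ≐ᵘ-resp-≃ : ∀ {p p′ A B} → p ≃ p′ → p ≐ᵘ A / B → p′ ≐ᵘ A / B
  ≐ᵘ-resp-≃ {mkℚᵘ P d} {mkℚᵘ P′ d′} {A} {B} (*≡* P*p′≡P′*p) (cross P*B≡A*p) =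
    cross $ ℤ.*-cancelʳ-≡ _ _ (+ suc d) (begin
    P′ * B * + suc d          ≡⟨ swap P′ B (+ suc d) ⟩
    P′ * + suc d * B          ≡⟨ cong (_* B) P*p′≡P′*p ⟨
    P * + suc d′ * B          ≡⟨ swap P (+ suc d′) B ⟩
    P * B * + suc d′          ≡⟨ cong (_* + suc d′) P*B≡A*p ⟩
    A * + suc d * + suc d′    ≡⟨ swap A (+ suc d) (+ suc d′) ⟩
    A * + suc d′ * + suc d    ∎)
    where
      open ≡-Reasoning
      swap : ∀ a b c → a * b * c ≡ a * c * b
      swap = solve-∀

  ≐-fraction : ∀ q → q ≐ ℚ.↥ q / ℚ.↧ q
  ≐-fraction (mkℚ _ _ _) = cross refl

  ≐-integer : ∀ i → i ℚ./ 1 ≐ i / + 1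
  ≐-integer i = ≐ᵘ-resp-≃ (ℚᵘ.≃-sym (ℚ.toℚᵘ-fromℚᵘ (mkℚᵘ i 0))) (cross refl)

  ≐-+ : ∀ {p q A B C E} → p ≐ A / B → q ≐ C / E → p ℚ.+ q ≐ A * E + C * B / B * E
  ≐-+ {p} {q} r s = ≐ᵘ-resp-≃ (ℚᵘ.≃-sym (ℚ.toℚᵘ-homo-+ p q)) (≐ᵘ-+ r s)

  ≐-* : ∀ {p q A B C E} → p ≐ A / B → q ≐ C / E → p ℚ.* q ≐ A * C / B * E
  ≐-* {p} {q} r s = ≐ᵘ-resp-≃ (ℚᵘ.≃-sym (ℚ.toℚᵘ-homo-* p q)) (≐ᵘ-* r s)

  ≐-- : ∀ {p q A B C E} → p ≐ A / B → q ≐ C / E → p ℚ.- q ≐ A * E + - C * B / B * E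
  ≐-- {q = q} r s = ≐-+ r (≐ᵘ-resp-≃ (ℚᵘ.≃-sym (ℚ.toℚᵘ-homo‿- q)) (≐ᵘ-neg s))

  ≐-halfPow : ∀ s → halfPow s ≐ + 1 / + (2 ^ s)
  ≐-halfPow zero = ≐-integer (+ 1)
  ≐-halfPow (suc s) =
    subst (halfPow (suc s) ≐ + 1 /_) (sym (ℤ.pos-* 2 (2 ^ s))) (≐-* {½} {A = + 1} {+ 2} (cross refl) (≐-halfPow s))

  ≐ᵘ-rescale : ∀ {p A B A′ B′} .{{_ : NonZero B}} → A * B′ ≡ A′ * B → p ≐ᵘ A / B → p ≐ᵘ A′ / B′
  ≐ᵘ-rescale {p} {A} {B} {A′} {B′} A*B′≡A′*B (cross p*B≡A*p) = cross $ ℤ.*-cancelʳ-≡ _ _ B (begin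
    ℚᵘ.↥ p * B′ * B        ≡⟨ swap (ℚᵘ.↥ p) B′ B ⟩
    ℚᵘ.↥ p * B * B′          ≡⟨ cong (_* B′) p*B≡A*p ⟩
    A * ℚᵘ.↧ p * B′          ≡⟨ swap A (ℚᵘ.↧ p) B′ ⟩
    A * B′ * ℚᵘ.↧ p          ≡⟨ cong (_* ℚᵘ.↧ p) A*B′≡A′*B ⟩
    A′ * B * ℚᵘ.↧ p          ≡⟨ swap A′ B (ℚᵘ.↧ p) ⟩
    A′ * ℚᵘ.↧ p * B        ∎)
    where
      open ≡-Reasoning
      swap : ∀ a b c → a * b * c ≡ a * c * b
      swap = solve-∀

module LatticeApproximation where

  open import Data.Bool using (Bool; T)
  open import Data.Bool.Properties using (T?)
  open import Data.Nat as ℕ using (ℕ; suc; NonZero; _<ᵇ_; _⊔_; _^_; ⌊_/2⌋)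
  import Data.Nat.Properties as ℕ
  open import Data.Nat.DivMod using (_/_; _%_; m%n<n; m≡m%n+[m/n]*n; m<n*o⇒m/o<n)
  open import Data.Integer as ℤ using (ℤ; +_; -[1+_]; ∣_∣; _+_; _*_; _-_; -_; _⊖_)
  import Data.Integer.Properties as ℤ
  open import Data.Integer.DivMod using (_%ℕ_; _/ℕ_; n%ℕd<d; a≡a%ℕn+[a/ℕn]*n)
  open import Data.Integer.Tactic.RingSolver using (solve-∀)
  open import Data.Fin using (Fin; toℕ; fromℕ<)
  open import Data.Fin.Properties using (all?; toℕ-fromℕ<)
  open import Data.List using (List; []; _∷_; cartesianProduct; cartesianProductWith)
  open import Data.List.Relation.Unary.Any using (Any; any?; satisfied)
  open import Data.Product using (Σ; _×_; _,_; uncurry; proj₂)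
  open import Relation.Nullary.Decidable using (toWitness)
  open import Relation.Binary.PropositionalEquality
  open OddPart

  normℤ : ℤ → ℤ → ℤ
  normℤ u v = u * u + + 10 * (v * v)

  square≡∣∣² : ∀ u → u * u ≡ + (∣ u ∣ ℕ.* ∣ u ∣)
  square≡∣∣² (+ n) = sym (ℤ.pos-* n n)
  square≡∣∣² -[1+ n ] = refl

  normℤ≡∣∣² : ∀ u v → normℤ u v ≡ + (∣ u ∣ ℕ.* ∣ u ∣ ℕ.+ 10 ℕ.* (∣ v ∣ ℕ.* ∣ v ∣))
  normℤ≡∣∣² u v = begin
    u * u + + 10 * (v * v)                                 ≡⟨ cong₂ (λ a b → a + + 10 * b) (square≡∣∣² u) (square≡∣∣² v) ⟩
    + (∣ u ∣ ℕ.* ∣ u ∣) + + 10 * + (∣ v ∣ ℕ.* ∣ v ∣)       ≡⟨ cong (λ b → + (∣ u ∣ ℕ.* ∣ u ∣) + b) (sym (ℤ.pos-* 10 (∣ v ∣ ℕ.* ∣ v ∣))) ⟩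
    + (∣ u ∣ ℕ.* ∣ u ∣) + + (10 ℕ.* (∣ v ∣ ℕ.* ∣ v ∣))     ≡⟨ sym (ℤ.pos-+ (∣ u ∣ ℕ.* ∣ u ∣) (10 ℕ.* (∣ v ∣ ℕ.* ∣ v ∣))) ⟩
    + (∣ u ∣ ℕ.* ∣ u ∣ ℕ.+ 10 ℕ.* (∣ v ∣ ℕ.* ∣ v ∣))       ∎
    where open ≡-Reasoning

  Residue : ℤ → ℕ → Set
  Residue x m = Σ ℕ λ X → Σ ℤ λ c → X ℕ.< m × x ≡ + 4 * + X + c * + m

  -- With m = 2h + 1, (h + 1)² is an inverse of 4 modulo m.
  quarter-residue : ∀ x m → Odd m → Residue x m
  quarter-residue x m odd = a %ℕ m , c , n%ℕd<d a m , x≡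
    where
      h = ⌊ m /2⌋
      instance
        m≢0 : NonZero m
        m≢0 = odd⇒nonZero odd
      a = x * (+ h + + 1) * (+ h + + 1)
      q = a /ℕ m
      c = + 4 * q - x * (+ m + + 2)
      +m≡2h+1 : + m ≡ + 2 * + h + + 1
      +m≡2h+1 = begin
        + m                   ≡⟨ cong +_ (sym (2*⌊n/2⌋+n%2≡n m)) ⟩
        + (2 ℕ.* h ℕ.+ m % 2) ≡⟨ cong (λ r → + (2 ℕ.* h ℕ.+ r)) odd ⟩
        + (2 ℕ.* h ℕ.+ 1)     ≡⟨ ℤ.pos-+ (2 ℕ.* h) 1 ⟩
        + (2 ℕ.* h) + + 1     ≡⟨ cong (_+ + 1) (ℤ.pos-* 2 h) ⟩
        + 2 * + h + + 1       ∎
        where open ≡-Reasoning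
      inverse : ∀ x q h → x ≡ + 4 * (x * (h + + 1) * (h + + 1) - q * (+ 2 * h + + 1))
                               + (+ 4 * q - x * ((+ 2 * h + + 1) + + 2)) * (+ 2 * h + + 1)
      inverse = solve-∀
      cancel : ∀ r s → r + s - s ≡ r
      cancel = solve-∀
      x≡ : x ≡ + 4 * + (a %ℕ m) + c * + m
      x≡ = begin
        x                                     ≡⟨ inverse x q (+ h) ⟩
        + 4 * (a - q * (+ 2 * + h + + 1)) + (+ 4 * q - x * ((+ 2 * + h + + 1) + + 2)) * (+ 2 * + h + + 1)
                                              ≡⟨ cong (λ M → + 4 * (a - q * M) + (+ 4 * q - x * (M + + 2)) * M) (sym +m≡2h+1) ⟩
        + 4 * (a - q * + m) + c * + m         ≡⟨ cong (λ b → + 4 * (b - q * + m) + c * + m) (a≡a%ℕn+[a/ℕn]*n a m) ⟩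
        + 4 * (+ (a %ℕ m) + q * + m - q * + m) + c * + m ≡⟨ cong (λ b → + 4 * b + c * + m) (cancel (+ (a %ℕ m)) (q * + m)) ⟩
        + 4 * + (a %ℕ m) + c * + m            ∎
        where open ≡-Reasoning

  data Sublattice : Set where
    4ℤ×4ℤ 4ℤ×2ℤ 2ℤ×ℤ : Sublattice

  step₁ step₂ level : Sublattice → ℕ
  step₁ 4ℤ×4ℤ = 4
  step₁ 4ℤ×2ℤ = 4
  step₁ 2ℤ×ℤ  = 2
  step₂ 4ℤ×4ℤ = 4
  step₂ 4ℤ×2ℤ = 2
  step₂ 2ℤ×ℤ  = 1
  level 4ℤ×4ℤ = 4
  level 4ℤ×2ℤ = 3
  level 2ℤ×ℤ  = 1

  record Shift : Set where
    constructor _∙⟨_,_⟩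
    field
      lattice : Sublattice
      k l : ℤ
    shift₁ shift₂ : ℤ
    shift₁ = + step₁ lattice * k
    shift₂ = + step₂ lattice * l

  open Shift

  norm-divisible : ∀ s X Y m →
                   Σ ℤ λ w → normℤ (+ 4 * X + shift₁ s * m) (+ 4 * Y + shift₂ s * m) ≡ + (2 ^ level (lattice s)) * w
  norm-divisible (4ℤ×4ℤ ∙⟨ k , l ⟩) X Y m = _ , identity X Y k l m
    where
      identity : ∀ X Y k l m → (+ 4 * X + + 4 * k * m) * (+ 4 * X + + 4 * k * m) + + 10 * ((+ 4 * Y + + 4 * l * m) * (+ 4 * Y + + 4 * l * m))
                               ≡ + 16 * ((X + k * m) * (X + k * m) + + 10 * ((Y + l * m) * (Y + l * m)))
      identity = solve-∀
  norm-divisible (4ℤ×2ℤ ∙⟨ k , l ⟩) X Y m = _ , identity X Y k l m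
    where
      identity : ∀ X Y k l m → (+ 4 * X + + 4 * k * m) * (+ 4 * X + + 4 * k * m) + + 10 * ((+ 4 * Y + + 2 * l * m) * (+ 4 * Y + + 2 * l * m))
                               ≡ + 8 * (+ 2 * ((X + k * m) * (X + k * m)) + + 5 * ((+ 2 * Y + l * m) * (+ 2 * Y + l * m)))
      identity = solve-∀
  norm-divisible (2ℤ×ℤ ∙⟨ k , l ⟩) X Y m = _ , identity X Y k l m
    where
      identity : ∀ X Y k l m → (+ 4 * X + + 2 * k * m) * (+ 4 * X + + 2 * k * m) + + 10 * ((+ 4 * Y + + 1 * l * m) * (+ 4 * Y + + 1 * l * m))
                               ≡ + 2 * (+ 2 * ((+ 2 * X + k * m) * (+ 2 * X + k * m)) + + 5 * ((+ 4 * Y + + 1 * l * m) * (+ 4 * Y + + 1 * l * m)))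
      identity = solve-∀

  oddPart-<-of-2^e-multiple : ∀ e {n w M} → n ≡ + (2 ^ e) * w → ∣ n ∣ ℕ.< 2 ^ e ℕ.* M → oddPart ∣ n ∣ ℕ.< M
  oddPart-<-of-2^e-multiple e {n} {w} {M} n≡ ∣n∣< = begin-strict
    oddPart ∣ n ∣                        ≡⟨ cong oddPart ∣n∣≡ ⟩
    oddPart (2 ^ e ℕ.* ∣ w ∣)            ≡⟨ oddPart-* (2 ^ e) ∣ w ∣ ⟩
    oddPart (2 ^ e) ℕ.* oddPart ∣ w ∣    ≡⟨ cong (ℕ._* oddPart ∣ w ∣) (oddPart-2^k e) ⟩
    1 ℕ.* oddPart ∣ w ∣                  ≡⟨ ℕ.*-identityˡ _ ⟩
    oddPart ∣ w ∣                        ≤⟨ oddPart-≤ ∣ w ∣ ⟩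
    ∣ w ∣                                <⟨ ℕ.*-cancelˡ-< (2 ^ e) ∣ w ∣ M (subst (ℕ._< 2 ^ e ℕ.* M) ∣n∣≡ ∣n∣<) ⟩
    M                                    ∎
    where
      open ℕ.≤-Reasoning
      ∣n∣≡ : ∣ n ∣ ≡ 2 ^ e ℕ.* ∣ w ∣
      ∣n∣≡ = trans (cong ∣_∣ n≡) (ℤ.abs-* (+ (2 ^ e)) w)

  cornerBound : ℤ → ℕ
  cornerBound s = ∣ s ∣ ⊔ ∣ s + + 1 ∣

  ∣s*m+r∣≤cornerBound : ∀ s {r m} → r ℕ.< m → ∣ s * + m + + r ∣ ℕ.≤ cornerBound s ℕ.* m
  ∣s*m+r∣≤cornerBound (+ n) {r} {m} r<m = begin
    ∣ + n * + m + + r ∣       ≡⟨ cong ∣_∣ (trans (cong (_+ + r) (sym (ℤ.pos-* n m))) (sym (ℤ.pos-+ (n ℕ.* m) r))) ⟩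
    n ℕ.* m ℕ.+ r             ≤⟨ ℕ.+-monoʳ-≤ (n ℕ.* m) (ℕ.<⇒≤ r<m) ⟩
    n ℕ.* m ℕ.+ m             ≡⟨ ℕ.+-comm (n ℕ.* m) m ⟩
    suc n ℕ.* m               ≤⟨ ℕ.*-monoˡ-≤ m (ℕ.m≤n⊔m n (suc n)) ⟩
    (n ⊔ suc n) ℕ.* m         ≡⟨ cong (λ t → (n ⊔ t) ℕ.* m) (ℕ.+-comm 1 n) ⟩
    cornerBound (+ n) ℕ.* m   ∎
    where open ℕ.≤-Reasoning
  ∣s*m+r∣≤cornerBound -[1+ n ] {r} {m} r<m = begin
    ∣ -[1+ n ] * + m + + r ∣             ≡⟨ cong ∣_∣ (trans (cong (_+ + r) -[1+n]*m≡) (ℤ.-m+n≡n⊖m (suc n ℕ.* m) r)) ⟩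
    ∣ r ⊖ suc n ℕ.* m ∣                  ≤⟨ ℤ.∣m⊝n∣≤m⊔n r (suc n ℕ.* m) ⟩
    r ⊔ suc n ℕ.* m                      ≡⟨ ℕ.m≤n⇒m⊔n≡n (ℕ.≤-trans (ℕ.<⇒≤ r<m) (ℕ.m≤n*m m (suc n))) ⟩
    suc n ℕ.* m                          ≤⟨ ℕ.*-monoˡ-≤ m (ℕ.m≤m⊔n (suc n) ∣ -[1+ n ] + + 1 ∣) ⟩
    cornerBound -[1+ n ] ℕ.* m           ∎
    where
      open ℕ.≤-Reasoning
      -[1+n]*m≡ : -[1+ n ] * + m ≡ - + (suc n ℕ.* m)
      -[1+n]*m≡ = trans (sym (ℤ.neg-distribˡ-* (+ suc n) (+ m))) (cong -_ (sym (ℤ.pos-* (suc n) m)))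

  8∣4X+Km∣≤cornerBound : ∀ X m .{{_ : NonZero m}} K →
                         8 ℕ.* ∣ + 4 * + X + K * + m ∣ ℕ.≤ cornerBound (+ (32 ℕ.* X / m) + + 8 * K) ℕ.* m
  8∣4X+Km∣≤cornerBound X m K = begin
    8 ℕ.* ∣ u ∣                        ≡⟨ ℤ.abs-* (+ 8) u ⟨
    ∣ + 8 * u ∣                        ≡⟨ cong ∣_∣ 8u≡ ⟩
    ∣ s * + m + + r ∣                  ≤⟨ ∣s*m+r∣≤cornerBound s (m%n<n (32 ℕ.* X) m) ⟩
    cornerBound s ℕ.* m                ∎
    where
      open ℕ.≤-Reasoning
      i = 32 ℕ.* X / m
      r = 32 ℕ.* X % m
      s = + i + + 8 * K
      u = + 4 * + X + K * + m
      +32X≡ : + 32 * + X ≡ + r + + i * + m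
      +32X≡ = trans (sym (ℤ.pos-* 32 X)) (trans (cong +_ (m≡m%n+[m/n]*n (32 ℕ.* X) m))
                (trans (ℤ.pos-+ r (i ℕ.* m)) (cong (λ t → + r + t) (ℤ.pos-* i m))))
      expand : ∀ X K m → + 8 * (+ 4 * X + K * m) ≡ + 32 * X + + 8 * K * m
      expand = solve-∀
      collect : ∀ r i K m → r + i * m + + 8 * K * m ≡ (i + + 8 * K) * m + r
      collect = solve-∀
      8u≡ : + 8 * u ≡ s * + m + + r
      8u≡ = trans (expand (+ X) K (+ m)) (trans (cong (_+ + 8 * K * + m) +32X≡) (collect (+ r) (+ i) K (+ m)))

  norm-<-from-scaled-bounds : ∀ {U V A B m T} .{{_ : NonZero m}} → 8 ℕ.* U ℕ.≤ A ℕ.* m → 8 ℕ.* V ℕ.≤ B ℕ.* m →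
                              A ℕ.* A ℕ.+ 10 ℕ.* (B ℕ.* B) ℕ.< 64 ℕ.* T → U ℕ.* U ℕ.+ 10 ℕ.* (V ℕ.* V) ℕ.< T ℕ.* (m ℕ.* m)
  norm-<-from-scaled-bounds {U} {V} {A} {B} {m} {T} 8U≤Am 8V≤Bm A²+10B²<64T = ℕ.*-cancelˡ-< 64 _ _ (begin-strict
    64 ℕ.* (U ℕ.* U ℕ.+ 10 ℕ.* (V ℕ.* V))
      ≡⟨ NS.solve (U ∷ V ∷ []) ⟩
    (8 ℕ.* U) ℕ.* (8 ℕ.* U) ℕ.+ 10 ℕ.* ((8 ℕ.* V) ℕ.* (8 ℕ.* V))
      ≤⟨ ℕ.+-mono-≤ (ℕ.*-mono-≤ 8U≤Am 8U≤Am) (ℕ.*-monoʳ-≤ 10 (ℕ.*-mono-≤ 8V≤Bm 8V≤Bm)) ⟩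
    (A ℕ.* m) ℕ.* (A ℕ.* m) ℕ.+ 10 ℕ.* ((B ℕ.* m) ℕ.* (B ℕ.* m))
      ≡⟨ NS.solve (A ∷ B ∷ m ∷ []) ⟩
    (A ℕ.* A ℕ.+ 10 ℕ.* (B ℕ.* B)) ℕ.* (m ℕ.* m)
      <⟨ ℕ.*-monoˡ-< (m ℕ.* m) {{ℕ.m*n≢0 m m}} A²+10B²<64T ⟩
    (64 ℕ.* T) ℕ.* (m ℕ.* m)
      ≡⟨ ℕ.*-assoc 64 T (m ℕ.* m) ⟩
    64 ℕ.* (T ℕ.* (m ℕ.* m)) ∎)
    where
      open ℕ.≤-Reasoning
      import Data.Nat.Tactic.RingSolver as NS

  -- The cell (i, j) is the square i ≤ 32X/m < i + 1, j ≤ 32Y/m < j + 1; by 8∣4X+Km∣≤cornerBound,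
  -- testing at its corners bounds the norm of (4X + k m, 4Y + l m) by 2^level m² throughout.
  covers : ℕ → ℕ → Shift → Bool
  covers i j s = A ℕ.* A ℕ.+ 10 ℕ.* (B ℕ.* B) <ᵇ 64 ℕ.* 2 ^ level (lattice s)
    where
      A = cornerBound (+ i + + 8 * shift₁ s)
      B = cornerBound (+ j + + 8 * shift₂ s)

  candidates : List Shift
  candidates = cartesianProductWith (λ L → uncurry (L ∙⟨_,_⟩)) (4ℤ×4ℤ ∷ 4ℤ×2ℤ ∷ 2ℤ×ℤ ∷ [])
                 (cartesianProduct (+ 0 ∷ -[1+ 0 ] ∷ -[1+ 1 ] ∷ []) (+ 0 ∷ -[1+ 0 ] ∷ -[1+ 1 ] ∷ -[1+ 2 ] ∷ []))

  -- Decided by evaluation; opaque so that uses of covering never unfold the certificate.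
  opaque
    covering : (i j : Fin 32) → Any (λ s → T (covers (toℕ i) (toℕ j) s)) candidates
    covering = toWitness {a? = all? λ i → all? λ j → any? (λ s → T? (covers (toℕ i) (toℕ j) s)) candidates} _

  oddPart-norm<-of-covers : ∀ {X Y m} .{{_ : NonZero m}} s → T (covers (32 ℕ.* X / m) (32 ℕ.* Y / m) s) →
                                oddPart ∣ normℤ (+ 4 * + X + shift₁ s * + m) (+ 4 * + Y + shift₂ s * + m) ∣ ℕ.< m ℕ.* m
  oddPart-norm<-of-covers {X} {Y} {m} s corners =
    oddPart-<-of-2^e-multiple (level (lattice s)) (proj₂ (norm-divisible s (+ X) (+ Y) (+ m))) ∣norm∣<
    where
      u = + 4 * + X + shift₁ s * + m
      v = + 4 * + Y + shift₂ s * + m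
      A = cornerBound (+ (32 ℕ.* X / m) + + 8 * shift₁ s)
      B = cornerBound (+ (32 ℕ.* Y / m) + + 8 * shift₂ s)
      ∣norm∣< : ∣ normℤ u v ∣ ℕ.< 2 ^ level (lattice s) ℕ.* (m ℕ.* m)
      ∣norm∣< = subst (ℕ._< 2 ^ level (lattice s) ℕ.* (m ℕ.* m)) (sym (cong ∣_∣ (normℤ≡∣∣² u v)))
        (norm-<-from-scaled-bounds {∣ u ∣} {∣ v ∣} {A} {B} {m} {2 ^ level (lattice s)}
          (8∣4X+Km∣≤cornerBound X m (shift₁ s)) (8∣4X+Km∣≤cornerBound Y m (shift₂ s))
          (ℕ.<ᵇ⇒< (A ℕ.* A ℕ.+ 10 ℕ.* (B ℕ.* B)) (64 ℕ.* 2 ^ level (lattice s)) corners))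

  grid-approximation : ∀ {X Y m} .{{_ : NonZero m}} → X ℕ.< m → Y ℕ.< m →
                       Σ ℤ λ k → Σ ℤ λ l → oddPart ∣ normℤ (+ 4 * + X + k * + m) (+ 4 * + Y + l * + m) ∣ ℕ.< m ℕ.* m
  grid-approximation {X} {Y} {m} X<m Y<m =
    approximate (fromℕ< (32X/m<32 X X<m)) (fromℕ< (32X/m<32 Y Y<m)) (toℕ-fromℕ< _) (toℕ-fromℕ< _)
    where
      32X/m<32 : ∀ X → X ℕ.< m → 32 ℕ.* X / m ℕ.< 32
      32X/m<32 X X<m = m<n*o⇒m/o<n (ℕ.*-monoʳ-< 32 X<m)
      approximate : (i j : Fin 32) → toℕ i ≡ 32 ℕ.* X / m → toℕ j ≡ 32 ℕ.* Y / m →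
                    Σ ℤ λ k → Σ ℤ λ l → oddPart ∣ normℤ (+ 4 * + X + k * + m) (+ 4 * + Y + l * + m) ∣ ℕ.< m ℕ.* m
      approximate i j i≡ j≡ with satisfied (covering i j)
      ... | s , covered =
        shift₁ s , shift₂ s , oddPart-norm<-of-covers {X} {Y} {m} s (subst₂ (λ i j → T (covers i j s)) i≡ j≡ covered)

  recentre : ∀ {x} X c₀ k m → x ≡ + 4 * + X + c₀ * + m → x - (c₀ - k) * + m ≡ + 4 * + X + k * + m
  recentre X c₀ k m refl = cancel (+ 4 * + X) c₀ k (+ m)
    where
      cancel : ∀ r c k m → r + c * m - (c - k) * m ≡ r + k * m
      cancel = solve-∀

  -- c + d√-10 is within N_S-distance 1 of (x + y√-10) / m.
  Approximable : ℤ → ℤ → ℕ → Set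
  Approximable x y m = Σ ℤ λ c → Σ ℤ λ d → oddPart ∣ normℤ (x - c * + m) (y - d * + m) ∣ ℕ.< m ℕ.* m

  residue-approximation : ∀ {x y m} .{{_ : NonZero m}} → Residue x m → Residue y m → Approximable x y m
  residue-approximation {m = m} (X , c₀ , X<m , x≡) (Y , d₀ , Y<m , y≡) =
    let k , l , approximated = grid-approximation {X} {Y} {m} X<m Y<m
    in c₀ - k , d₀ - l ,
       subst (λ n → oddPart ∣ n ∣ ℕ.< m ℕ.* m) (sym (cong₂ normℤ (recentre X c₀ k m x≡) (recentre Y d₀ l m y≡))) approximated

  odd-modulus-approximation : ∀ x y {m} → Odd m → Approximable x y m
  odd-modulus-approximation x y {m} odd =
    residue-approximation {{odd⇒nonZero odd}} (quarter-residue x m odd) (quarter-residue y m odd)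

open import Data.Nat as ℕ using (ℕ; suc; _^_)
import Data.Nat.Properties as ℕ
open import Data.Integer using (+_; ∣_∣; _+_; _*_; -_; _-_; _<_; +<+; NonZero)
import Data.Integer.Properties as ℤ
open import Data.Integer.Tactic.RingSolver using (solve-∀)
open import Data.Rational as ℚ using (mkℚ; 1ℚ)
import Data.Rational.Properties as ℚ
open import Data.Rational.Unnormalised as ℚᵘ using (mkℚᵘ; *<*)
import Data.Rational.Unnormalised.Properties as ℚᵘ
open import Data.Product using (Σ; _,_)
open import Relation.Binary.PropositionalEquality
open OddPart
open LatticeApproximation
open Fractions

mkℚᵘ<1 : ∀ {a b} → a ℕ.< b → mkℚᵘ (+ a) (b ℕ.∸ 1) ℚᵘ.< ℚᵘ.1ℚᵘ
mkℚᵘ<1 {a} {b@(suc _)} a<b = *<* (subst₂ _<_ (sym (ℤ.*-identityʳ (+ a))) (sym (ℤ.*-identityˡ (+ b))) (+<+ a<b))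

N₂<1 : ∀ {q A B} .{{_ : ℕ.NonZero B}} → q ≐ A / + B → oddPart ∣ A ∣ ℕ.< oddPart B → N₂ q ℚ.< 1ℚ
N₂<1 {mkℚ n d-1 _} {A} {B} (cross n*B≡A*d) oddA<oddB =
  ℚ.toℚᵘ-cancel-< (ℚᵘ.<-respˡ-≃ (ℚᵘ.≃-sym (ℚ.toℚᵘ-fromℚᵘ _)) (mkℚᵘ<1 odd-n<odd-d))
  where
    d = suc d-1
    cross-odd : oddPart ∣ n ∣ ℕ.* oddPart B ≡ oddPart ∣ A ∣ ℕ.* oddPart d
    cross-odd = begin
      oddPart ∣ n ∣ ℕ.* oddPart B    ≡⟨ oddPart-* ∣ n ∣ B ⟨
      oddPart (∣ n ∣ ℕ.* B)          ≡⟨ cong oddPart (trans (sym (ℤ.abs-* n (+ B))) (trans (cong ∣_∣ n*B≡A*d) (ℤ.abs-* A (+ d)))) ⟩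
      oddPart (∣ A ∣ ℕ.* d)          ≡⟨ oddPart-* ∣ A ∣ d ⟩
      oddPart ∣ A ∣ ℕ.* oddPart d    ∎
      where open ≡-Reasoning
    odd-n<odd-d : oddPart ∣ n ∣ ℕ.< oddPart d
    odd-n<odd-d = ℕ.*-cancelʳ-< (oddPart B) (oddPart ∣ n ∣) (oddPart d) (begin-strict
      oddPart ∣ n ∣ ℕ.* oddPart B    ≡⟨ cross-odd ⟩
      oddPart ∣ A ∣ ℕ.* oddPart d    <⟨ ℕ.*-monoˡ-< (oddPart d) {{odd⇒nonZero (oddPart-odd {d})}} oddA<oddB ⟩
      oddPart B ℕ.* oddPart d        ≡⟨ ℕ.*-comm (oddPart B) (oddPart d) ⟩
      oddPart d ℕ.* oddPart B        ∎)
      where open ℕ.≤-Reasoning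

≐-sub-dyadic : ∀ p c s {e m D} → ℚ.↧ₙ p ℕ.* e ≡ D → 2 ^ s ℕ.* m ≡ D →
               p ℚ.- (c ℚ./ 1) ℚ.* halfPow s ≐ ℚ.↥ p * + e - c * + m / + D
≐-sub-dyadic p@(mkℚ n d-1 _) c s {e} {m} {D} de≡D 2^sm≡D =
  ≐ᵘ-rescale {{nz}} cross-eq (≐-- (≐-fraction p) (≐-* (≐-integer c) (≐-halfPow s)))
  where
    d = + suc d-1
    P = + (2 ^ s)
    instance
      nzP : NonZero P
      nzP = ℕ.m^n≢0 2 s
    nz : NonZero (d * (+ 1 * P))
    nz = ℤ.i*j≢0 d (+ 1 * P) {{_}} {{ℤ.i*j≢0 (+ 1) P}}
    expand : ∀ n c d P D → (n * (+ 1 * P) + - (c * + 1) * d) * D ≡ n * P * D - c * d * D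
    expand = solve-∀
    collect : ∀ n c d e P m → n * P * (d * e) - c * d * (P * m) ≡ (n * e - c * m) * (d * (+ 1 * P))
    collect = solve-∀
    cross-eq : (n * (+ 1 * P) + - (c * + 1) * d) * + D ≡ (n * + e - c * + m) * (d * (+ 1 * P))
    cross-eq = begin
      (n * (+ 1 * P) + - (c * + 1) * d) * + D ≡⟨ expand n c d P (+ D) ⟩
      n * P * + D - c * d * + D               ≡⟨ cong₂ (λ a b → n * P * a - c * d * b)
                                                    (trans (cong +_ (sym de≡D)) (ℤ.pos-* (suc d-1) e))
                                                    (trans (cong +_ (sym 2^sm≡D)) (ℤ.pos-* (2 ^ s) m)) ⟩
      n * P * (d * + e) - c * d * (P * + m)   ≡⟨ collect n c d (+ e) P (+ m) ⟩
      (n * + e - c * + m) * (d * (+ 1 * P))   ∎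
      where open ≡-Reasoning

≐-N : ∀ {a b u v D} .{{_ : ℕ.NonZero D}} → a ≐ u / + D → b ≐ v / + D → N (a , b) ≐ normℤ u v / + (D ℕ.* D)
≐-N {u = u} {v} {D} ra rb = ≐ᵘ-rescale {{nz}} cross-eq (≐-+ (≐-* ra ra) (≐-* (≐-integer (+ 10)) (≐-* rb rb)))
  where
    nz : NonZero ((+ D * + D) * (+ 1 * (+ D * + D)))
    nz = ℤ.i*j≢0 D² (+ 1 * D²) {{D²≢0}} {{ℤ.i*j≢0 (+ 1) D² {{_}} {{D²≢0}}}}
      where
        D² = + D * + D
        D²≢0 = ℤ.i*j≢0 (+ D) (+ D)
    identity : ∀ u v D → (u * u * (+ 1 * (D * D)) + (+ 10 * (v * v)) * (D * D)) * (D * D)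
                         ≡ (u * u + + 10 * (v * v)) * ((D * D) * (+ 1 * (D * D)))
    identity = solve-∀
    cross-eq : (u * u * (+ 1 * (+ D * + D)) + (+ 10 * (v * v)) * (+ D * + D)) * + (D ℕ.* D)
               ≡ normℤ u v * ((+ D * + D) * (+ 1 * (+ D * + D)))
    cross-eq = trans (cong ((u * u * (+ 1 * (+ D * + D)) + (+ 10 * (v * v)) * (+ D * + D)) *_) (ℤ.pos-* D D)) (identity u v (+ D))

N_S-dyadic-shift-<1 : ∀ p₁ p₂ c d s {m} → ℚ.↧ₙ p₁ ℕ.* ℚ.↧ₙ p₂ ≡ 2 ^ s ℕ.* m → Odd m →
                      oddPart ∣ normℤ (ℚ.↥ p₁ * + ℚ.↧ₙ p₂ - c * + m) (ℚ.↥ p₂ * + ℚ.↧ₙ p₁ - d * + m) ∣ ℕ.< m ℕ.* m →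
                      N_S ((p₁ , p₂) -K ι (c , d , s)) ℚ.< 1ℚ
N_S-dyadic-shift-<1 p₁ p₂ c d s {m} D≡2^sm odd approximated =
  N₂<1 {N ((p₁ , p₂) -K ι (c , d , s))} {normℤ (x - c * + m) (y - d * + m)} {D ℕ.* D} {{D²≢0}} representation bound
  where
    d₁ = ℚ.↧ₙ p₁
    d₂ = ℚ.↧ₙ p₂
    D = d₁ ℕ.* d₂
    x = ℚ.↥ p₁ * + d₂
    y = ℚ.↥ p₂ * + d₁
    D²≢0 : ℕ.NonZero (D ℕ.* D)
    D²≢0 = ℕ.m*n≢0 D D {{ℕ.m*n≢0 d₁ d₂}} {{ℕ.m*n≢0 d₁ d₂}}
    representation : N ((p₁ , p₂) -K ι (c , d , s)) ≐ normℤ (x - c * + m) (y - d * + m) / + (D ℕ.* D)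
    representation = ≐-N {{ℕ.m*n≢0 d₁ d₂}} (≐-sub-dyadic p₁ c s refl (sym D≡2^sm))
                                            (≐-sub-dyadic p₂ d s (ℕ.*-comm d₂ d₁) (sym D≡2^sm))
    oddPart-D² : oddPart (D ℕ.* D) ≡ m ℕ.* m
    oddPart-D² = trans (oddPart-* D D) (cong₂ ℕ._*_ oddPart-D oddPart-D)
      where oddPart-D = trans (cong oddPart D≡2^sm) (oddPart-2^k*o s odd)
    bound : oddPart ∣ normℤ (x - c * + m) (y - d * + m) ∣ ℕ.< oddPart (D ℕ.* D)
    bound = subst (oddPart ∣ normℤ (x - c * + m) (y - d * + m) ∣ ℕ.<_) (sym oddPart-D²) approximated

proposition1 : SNormEuclidean
proposition1 (p₁ , p₂) = approximate (oddPart-TwoAdicForm D)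
  where
    D = ℚ.↧ₙ p₁ ℕ.* ℚ.↧ₙ p₂
    x = ℚ.↥ p₁ * + ℚ.↧ₙ p₂
    y = ℚ.↥ p₂ * + ℚ.↧ₙ p₁
    approximate : Σ ℕ (λ s → TwoAdicForm D s (oddPart D)) → Σ O_S λ γ → N_S ((p₁ , p₂) -K ι γ) ℚ.< 1ℚ
    approximate (s , D≡2^sm , odd) = conclude (odd-modulus-approximation x y odd)
      where
        conclude : Approximable x y (oddPart D) → Σ O_S λ γ → N_S ((p₁ , p₂) -K ι γ) ℚ.< 1ℚ
        conclude (c , d , approximated) = (c , d , s) , N_S-dyadic-shift-<1 p₁ p₂ c d s D≡2^sm odd approximated
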